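{- For every integer $k\geq 2$, let $x^k$ denote the unary pattern consisting of the variable $x$ repeated $k$ times. Then $\lambda_\simeq(x^k)=3$ if $k\in\{2,3\}$, and $\lambda_\simeq(x^k)=2$ if $k\geq 4$.
   Context: For a word $u=u_1\cdots u_n$ (letters $u_i$), its reversal is $u^R=u_n\cdots u_1$. Let $\simeq$ be the equivalence relation on words with $u\simeq u'$ iff $u'=u$ or $u'=u^R$. A pattern is a word $p=p_1\cdots p_n$ over an alphabet of variables. A word $w$ encounters $p$ up to $\simeq$ if $w$ has a factor $X_1X_2\cdots X_n$ where each $X_i$ is a nonempty word and $X_i\simeq X_j$ whenever $p_i=p_j$; otherwise $w$ avoids $p$ up to $\simeq$. The pattern $p$ is $k$-avoidable up to $\simeq$ if some infinite word over a $k$-letter alphabet avoids $p$ up to $\simeq$. The avoidability index $\lambda_\simeq(p)$ is the least positive integer $k$ such that $p$ is $k$-avoidable up to $\simeq$ (or $\infty$ if there is none). -}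

module Defs where

open import Data.Nat using (ℕ; zero; suc; _+_; _<_; _≤_)
open import Data.Fin using (Fin)
open import Data.List using (List; []; _∷_; reverse; concat; length)
open import Data.Vec using (Vec; lookup; toList; replicate)
open import Data.Product using (Σ; ∃; ∃-syntax; _×_)
open import Data.Sum using (_⊎_)
open import Relation.Binary.PropositionalEquality using (_≡_; _≢_)
open import Relation.Nullary using (¬_)

_≃_ : {A : Set} → List A → List A → Set
u ≃ u' = (u' ≡ u) ⊎ (u' ≡ reverse u)

Pattern : ℕ → Set
Pattern n = Vec ℕ n

InfWord : ℕ → Set
InfWord k = ℕ → Fin k

factor : {k : ℕ} → InfWord k → ℕ → ℕ → List (Fin k)
factor w i zero = []
factor w i (suc m) = w i ∷ factor w (suc i) m

Encounters : {k n : ℕ} → InfWord k → Pattern n → Set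
Encounters {k} {n} w p =
  ∃[ i ] Σ (Vec (List (Fin k)) n) λ Xs →
      (∀ a → 1 ≤ length (lookup Xs a))
    × (∀ a b → lookup p a ≡ lookup p b → lookup Xs a ≃ lookup Xs b)
    × (factor w i (length (concat (toList Xs))) ≡ concat (toList Xs))

Avoidable : {n : ℕ} → ℕ → Pattern n → Set
Avoidable {n} k p = Σ (InfWord k) λ w → ¬ Encounters w p

AvoidabilityIndexIs : {n : ℕ} → Pattern n → ℕ → Set
AvoidabilityIndexIs p k =
  1 ≤ k × Avoidable k p × (∀ j → 1 ≤ j → j < k → ¬ Avoidable j p)

unary : (k : ℕ) → Pattern k
unary k = replicate k 0

-- A word encounters x^k up to reversal exactly when it has k consecutive blocks of
-- one length p, each equal to the first block or to its reversal.
--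
-- Squares (k = 2, 3): the ternary word of steps t(n)t(n+1) of the Thue–Morse word t avoids them.
-- A reversed square has two equal adjacent letters in its middle, so it suffices that the step
-- word is square-free; and a square in it makes t either agree with itself one period later on
-- p + 1 letters (an overlap, impossible by the classical halving argument for t) or be constant
-- on p + 1 letters.
--
-- Fourth powers (k ≥ 4): the period-doubling word d, d(2n) = 1 and d(2n+1) = ¬ d(n), avoids them.
-- If some block of a fourth power is matched with the first block at positions of opposite parity
-- (a reversed block, or a copied block at odd distance), the first block is all 1, hence so is the
-- whole fourth power, but d has no four consecutive 1s. Otherwise p is even and all blocks are
-- plain copies, and sampling the odd positions yields a fourth power of period p / 2.
--
-- Lower bounds: every word over one letter is a k-th power, and an exhaustive search shows that
-- every binary word of length 10 contains a cube up to reversal.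

module Submission where

open import Defs
open import Data.Bool using (Bool; true; false; not; _xor_; if_then_else_)
open import Data.Bool.Properties using (not-injective; not-involutive; not-¬)
open import Data.Empty using (⊥)
open import Data.Fin as Fin using (Fin; toℕ; fromℕ<)
open import Data.Fin.Properties using (toℕ<n; toℕ-fromℕ<) renaming (_≟_ to _≟ᶠ_)
open import Data.List using (List; []; _∷_; _++_; [_]; reverse; concat; length; _∷ʳ_)
open import Data.List.Properties
  using (∷-injective; length-++; length-reverse; reverse-involutive; reverse-++; ≡-dec)
open import Data.Maybe using (Maybe; just; nothing; zipWith; from-just)
open import Data.Nat using (ℕ; zero; suc; _+_; _*_; _≤_; _<_; z≤n; s≤s; z<s; ⌊_/2⌋; _≤?_; _<?_)
open import Data.Nat.Induction using (<-wellFounded)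
open import Data.Nat.Properties
open import Data.Nat.Tactic.RingSolver using (solve-∀)
open import Data.Product using (∃; ∃₂; _×_; _,_; proj₁; proj₂)
open import Data.Sum using (_⊎_; inj₁; inj₂)
open import Data.Vec as Vec using (Vec; lookup; toList)
open import Data.Vec.Properties using (lookup-replicate)
open import Function using (_∘_)
open import Induction.WellFounded using (Acc; acc)
open import Relation.Binary.PropositionalEquality hiding ([_])
open import Relation.Nullary using (¬_; Dec; yes; no; contradiction)
open import Relation.Nullary.Decidable using (_×-dec_; _⊎-dec_)
open import Relation.Binary.Definitions using (DecidableEquality)

reindex : ∀ {A : Set} (f : ℕ → A) {x x′ y y′} → x ≡ x′ → y ≡ y′ → f x ≡ f y → f x′ ≡ f y′
reindex f refl refl e = e

≃-sym : {A : Set} {u v : List A} → u ≃ v → v ≃ u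
≃-sym (inj₁ refl) = inj₁ refl
≃-sym {u = u} (inj₂ refl) = inj₂ (sym (reverse-involutive u))

≃-trans : {A : Set} {u v x : List A} → u ≃ v → v ≃ x → u ≃ x
≃-trans (inj₁ refl) v≃x = v≃x
≃-trans (inj₂ refl) (inj₁ refl) = inj₂ refl
≃-trans {u = u} (inj₂ refl) (inj₂ refl) = inj₁ (reverse-involutive u)

≃-length : {A : Set} {u v : List A} → u ≃ v → length v ≡ length u
≃-length (inj₁ refl) = refl
≃-length {u = u} (inj₂ refl) = length-reverse u

-- Powers up to reversal

module _ {A : Set} (f : ℕ → A) where

  record Recurs (i o n : ℕ) : Set where
    constructor recurs
    field at : ∀ j → j < n → f (i + o + j) ≡ f (i + j)

  record RecursReversed (i o n : ℕ) : Set where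
    constructor recursReversed
    field at : ∀ j k → suc (j + k) ≡ n → f (i + o + j) ≡ f (i + k)

  Recurs≃ : ℕ → ℕ → ℕ → Set
  Recurs≃ i o n = Recurs i o n ⊎ RecursReversed i o n

  PowerRecurs : ℕ → ℕ → ℕ → Set
  PowerRecurs n i p = ∀ {k} → k < n → Recurs≃ i (k * p) p

  recurs-zero : ∀ i n → Recurs i 0 n
  recurs-zero i n = recurs λ j _ → cong (λ x → f (x + j)) (+-identityʳ i)

  recurs-suc : ∀ {i o n} → Recurs i o (suc n) → Recurs (suc i) o n
  recurs-suc {i} {o} (recurs rec) =
    recurs λ j j<n → reindex f (+-suc (i + o) j) (+-suc i j) (rec (suc j) (s≤s j<n))

  recurs-≤ : ∀ {i o m n} → m ≤ n → Recurs i o n → Recurs i o m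
  recurs-≤ m≤n (recurs rec) = recurs λ j j<m → rec j (<-≤-trans j<m m≤n)

  recurs-head : ∀ {i o n} → Recurs i o (suc n) → f (i + o) ≡ f i
  recurs-head {i} {o} (recurs rec) = reindex f (+-identityʳ (i + o)) (+-identityʳ i) (rec 0 (s≤s z≤n))

  recursReversed⇒adjacent : ∀ {i m} → RecursReversed i (suc m) (suc m) → Recurs (i + m) 1 1
  recursReversed⇒adjacent {i} {m} (recursReversed rev) = recurs λ where
    zero    _        → reindex f (cong (_+ 0) (trans (+-suc i m) (+-comm 1 (i + m))))
                                 (sym (+-identityʳ (i + m))) (rev 0 m refl)
    (suc j) (s≤s ())

module _ {A B : Set} {g : A → B} (g-injective : ∀ {x y} → g x ≡ g y → x ≡ y) (f : ℕ → A) where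

  powerRecurs-injective : ∀ {n i p} → PowerRecurs (g ∘ f) n i p → PowerRecurs f n i p
  powerRecurs-injective power k<n with power k<n
  ... | inj₁ (recurs rec)         = inj₁ (recurs λ j j<p → g-injective (rec j j<p))
  ... | inj₂ (recursReversed rev) = inj₂ (recursReversed λ j k e → g-injective (rev j k e))

module _ {k : ℕ} (w : InfWord k) where

  length-factor : ∀ i n → length (factor w i n) ≡ n
  length-factor i zero    = refl
  length-factor i (suc n) = cong suc (length-factor (suc i) n)

  factor-+ : ∀ i m n → factor w i (m + n) ≡ factor w i m ++ factor w (i + m) n
  factor-+ i zero    n = cong (λ x → factor w x n) (sym (+-identityʳ i))
  factor-+ i (suc m) n = cong (w i ∷_) (trans (factor-+ (suc i) m n)
                           (cong (λ x → factor w (suc i) m ++ factor w x n) (sym (+-suc i m))))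

  factor-∷ʳ : ∀ i n → factor w i (suc n) ≡ factor w i n ∷ʳ w (i + n)
  factor-∷ʳ i n = subst (λ m → factor w i m ≡ factor w i n ∷ʳ w (i + n)) (+-comm n 1) (factor-+ i n 1)

  Occurs : ℕ → List (Fin k) → Set
  Occurs i u = factor w i (length u) ≡ u

  occurs-++⁻ : ∀ u v i → Occurs i (u ++ v) → Occurs i u × Occurs (i + length u) v
  occurs-++⁻ []      v i occ = refl , subst (λ x → Occurs x v) (sym (+-identityʳ i)) occ
  occurs-++⁻ (a ∷ u) v i occ with ∷-injective occ
  ... | refl , occ′ with occurs-++⁻ u v (suc i) occ′
  ...   | occ-u , occ-v = cong (w i ∷_) occ-u , subst (λ x → Occurs x v) (sym (+-suc i (length u))) occ-v

  Power : ℕ → ℕ → ℕ → Set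
  Power n i p = ∀ {j} → j < n → factor w i p ≃ factor w (i + j * p) p

  blocks : ℕ → ℕ → (n : ℕ) → Vec (List (Fin k)) n
  blocks i p zero    = Vec.[]
  blocks i p (suc n) = factor w i p Vec.∷ blocks (i + p) p n

  lookup-blocks : ∀ i p {n} (a : Fin n) → lookup (blocks i p n) a ≡ factor w (i + toℕ a * p) p
  lookup-blocks i p Fin.zero    = cong (λ x → factor w x p) (sym (+-identityʳ i))
  lookup-blocks i p (Fin.suc a) =
    trans (lookup-blocks (i + p) p a) (cong (λ x → factor w x p) (+-assoc i p (toℕ a * p)))

  concat-blocks : ∀ i p n → concat (toList (blocks i p n)) ≡ factor w i (n * p)
  concat-blocks i p zero    = refl
  concat-blocks i p (suc n) =
    trans (cong (factor w i p ++_) (concat-blocks (i + p) p n)) (sym (factor-+ i p (n * p)))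

  occurs-concat : ∀ {n} i p (us : Vec (List (Fin k)) n) → (∀ a → length (lookup us a) ≡ p) →
                  Occurs i (concat (toList us)) → ∀ a → factor w (i + toℕ a * p) p ≡ lookup us a
  occurs-concat i p (u Vec.∷ us) len occ a with occurs-++⁻ u (concat (toList us)) i occ | len Fin.zero
  occurs-concat i p (u Vec.∷ us) len occ Fin.zero    | occ-u , _ | refl =
    trans (cong (λ x → factor w x (length u)) (+-identityʳ i)) occ-u
  occurs-concat i p (u Vec.∷ us) len occ (Fin.suc a) | _ , occ-us | refl =
    trans (cong (λ x → factor w x p) (sym (+-assoc i p (toℕ a * p))))
          (occurs-concat (i + p) p us (len ∘ Fin.suc) occ-us a)

  power⇒encounters : ∀ {n i p} → 1 ≤ p → Power n i p → Encounters w (unary n)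
  power⇒encounters {n} {i} {p} 1≤p power = i , blocks i p n , nonempty , related , occurs
    where
      nonempty : ∀ a → 1 ≤ length (lookup (blocks i p n) a)
      nonempty a rewrite lookup-blocks i p a | length-factor (i + toℕ a * p) p = 1≤p
      related : ∀ a b → lookup (unary n) a ≡ lookup (unary n) b →
                lookup (blocks i p n) a ≃ lookup (blocks i p n) b
      related a b _ rewrite lookup-blocks i p a | lookup-blocks i p b =
        ≃-trans (≃-sym (power (toℕ<n a))) (power (toℕ<n b))
      occurs : Occurs i (concat (toList (blocks i p n)))
      occurs rewrite concat-blocks i p n = cong (factor w i) (length-factor i (n * p))

  encounters⇒power : ∀ {n} → Encounters w (unary (suc n)) → ∃₂ λ i p → 1 ≤ p × Power (suc n) i p
  encounters⇒power {n} (i , u Vec.∷ us , nonempty , related , occurs) =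
    i , length u , nonempty Fin.zero , power
    where
      u≃ : ∀ a → u ≃ lookup (u Vec.∷ us) a
      u≃ a = related Fin.zero a
        (trans (lookup-replicate {n = suc n} Fin.zero zero) (sym (lookup-replicate a zero)))
      power : Power (suc n) i (length u)
      power {j} j<1+n = subst₂ _≃_ (sym (proj₁ (occurs-++⁻ u _ i occurs))) (sym block) (u≃ a)
        where
          a = fromℕ< j<1+n
          block : factor w (i + j * length u) (length u) ≡ lookup (u Vec.∷ us) a
          block = trans (cong (λ m → factor w (i + m * length u) (length u)) (sym (toℕ-fromℕ< j<1+n)))
                        (occurs-concat i (length u) (u Vec.∷ us) (≃-length ∘ u≃) occurs a)

  factor-≡⇒recurs : ∀ i o n → factor w (i + o) n ≡ factor w i n → Recurs w i o n
  factor-≡⇒recurs i o n eq = recurs (agree i (i + o) n eq)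
    where
      agree : ∀ i c n → factor w c n ≡ factor w i n → ∀ j → j < n → w (c + j) ≡ w (i + j)
      agree i c (suc n) eq zero    _         =
        reindex w (sym (+-identityʳ c)) (sym (+-identityʳ i)) (proj₁ (∷-injective eq))
      agree i c (suc n) eq (suc j) (s≤s j<n) =
        reindex w (sym (+-suc c j)) (sym (+-suc i j))
          (agree (suc i) (suc c) n (proj₂ (∷-injective eq)) j j<n)

  factor-reverse⇒recursReversed : ∀ i o n → factor w (i + o) n ≡ reverse (factor w i n) →
                                  RecursReversed w i o n
  factor-reverse⇒recursReversed i o n eq = recursReversed (agree i (i + o) n eq)
    where
      agree : ∀ i c n → factor w c n ≡ reverse (factor w i n) →
              ∀ j k → suc (j + k) ≡ n → w (c + j) ≡ w (i + k)
      agree i c (suc n) eq j k e with ∷-injective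
        (trans eq (trans (cong reverse (factor-∷ʳ i n)) (reverse-++ (factor w i n) [ w (i + n) ])))
      agree i c (suc n) eq zero    k e | head , _    =
        reindex w (sym (+-identityʳ c)) (cong (i +_) (sym (suc-injective e))) head
      agree i c (suc n) eq (suc j) k e | _    , tail =
        reindex w (sym (+-suc c j)) refl (agree i (suc c) n tail j k (suc-injective e))

  ≃⇒recurs≃ : ∀ {i o n} → factor w i n ≃ factor w (i + o) n → Recurs≃ w i o n
  ≃⇒recurs≃ {i} {o} {n} (inj₁ eq) = inj₁ (factor-≡⇒recurs i o n eq)
  ≃⇒recurs≃ {i} {o} {n} (inj₂ eq) = inj₂ (factor-reverse⇒recursReversed i o n eq)

  power⇒powerRecurs : ∀ {n i p} → Power n i p → PowerRecurs w n i p
  power⇒powerRecurs power k<n = ≃⇒recurs≃ (power k<n)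

-- The Thue–Morse and period-doubling sequences

data Parity : ℕ → Set where
  even : ∀ m → Parity (m + m)
  odd  : ∀ m → Parity (suc (m + m))

parity : ∀ n → Parity n
parity zero = even zero
parity (suc n) with parity n
... | even m = odd m
... | odd m  = subst Parity (cong suc (+-suc m m)) (even (suc m))

isOdd : ℕ → Bool
isOdd zero          = false
isOdd (suc zero)    = true
isOdd (suc (suc n)) = isOdd n

isOdd-double : ∀ n → isOdd (n + n) ≡ false
isOdd-double zero    = refl
isOdd-double (suc n) = trans (cong (isOdd ∘ suc) (+-suc n n)) (isOdd-double n)

isOdd-suc-double : ∀ n → isOdd (suc (n + n)) ≡ true
isOdd-suc-double zero    = refl
isOdd-suc-double (suc n) = trans (cong (isOdd ∘ suc ∘ suc) (+-suc n n)) (isOdd-suc-double n)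

⌊suc-double/2⌋ : ∀ n → ⌊ suc (n + n) /2⌋ ≡ n
⌊suc-double/2⌋ zero    = refl
⌊suc-double/2⌋ (suc n) = cong suc (trans (cong ⌊_/2⌋ (+-suc n n)) (⌊suc-double/2⌋ n))

module DigitRecursive {A : Set} (base : A) (step : Bool → A → A) where

  private
    go : ∀ n → Acc _<_ n → A
    go zero    _        = base
    go (suc n) (acc rs) = step (isOdd (suc n)) (go ⌊ suc n /2⌋ (rs (⌊n/2⌋<n n)))

    go-irrelevant : ∀ n (a b : Acc _<_ n) → go n a ≡ go n b
    go-irrelevant zero    _        _        = refl
    go-irrelevant (suc n) (acc rs) (acc ss) =
      cong (step (isOdd (suc n))) (go-irrelevant ⌊ suc n /2⌋ (rs (⌊n/2⌋<n n)) (ss (⌊n/2⌋<n n)))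

  -- Abstract, so that unification sees sequence n rather than the unfolded recursion on Acc.
  abstract
    sequence : ℕ → A
    sequence n = go n (<-wellFounded n)

    sequence-zero : sequence zero ≡ base
    sequence-zero = refl

    sequence-suc : ∀ n → sequence (suc n) ≡ step (isOdd (suc n)) (sequence ⌊ suc n /2⌋)
    sequence-suc n = go-irrelevant (suc n) (<-wellFounded (suc n)) (acc λ {m} _ → <-wellFounded m)

  sequence-even : step false base ≡ base → ∀ n → sequence (n + n) ≡ step false (sequence n)
  sequence-even step-base zero    =
    trans sequence-zero (sym (trans (cong (step false) sequence-zero) step-base))
  sequence-even step-base (suc n) = trans (sequence-suc (n + suc n))
    (cong₂ step (isOdd-double (suc n)) (cong sequence (sym (n≡⌊n+n/2⌋ (suc n)))))

  sequence-odd : ∀ n → sequence (suc (n + n)) ≡ step true (sequence n)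
  sequence-odd n = trans (sequence-suc (n + n))
    (cong₂ step (isOdd-suc-double n) (cong sequence (⌊suc-double/2⌋ n)))

thueMorse : ℕ → Bool
thueMorse = DigitRecursive.sequence false _xor_

thueMorse-even : ∀ n → thueMorse (n + n) ≡ thueMorse n
thueMorse-even = DigitRecursive.sequence-even false _xor_ refl

thueMorse-odd : ∀ n → thueMorse (suc (n + n)) ≡ not (thueMorse n)
thueMorse-odd = DigitRecursive.sequence-odd false _xor_

periodDoubling : ℕ → Bool
periodDoubling = DigitRecursive.sequence true (λ b v → if b then not v else true)

periodDoubling-even : ∀ n → periodDoubling (n + n) ≡ true
periodDoubling-even = DigitRecursive.sequence-even true (λ b v → if b then not v else true) refl

periodDoubling-odd : ∀ n → periodDoubling (suc (n + n)) ≡ not (periodDoubling n)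
periodDoubling-odd = DigitRecursive.sequence-odd true (λ b v → if b then not v else true)

module _ {A : Set} {f : ℕ → A} {g : A → A} (g-injective : ∀ {x y} → g x ≡ g y → x ≡ y) where

  recurs-halve : ∀ b → (∀ m → f (b + (m + m)) ≡ g (f m)) → ∀ {a o n L} → (∀ {j} → j < n → j + j < L) →
                 Recurs f (b + (a + a)) (o + o) L → Recurs f a o n
  recurs-halve b f-digit {a} {o} sample (recurs rec) = recurs λ j j<n → g-injective (begin
    g (f (a + o + j))                    ≡⟨ f-digit (a + o + j) ⟨
    f (b + ((a + o + j) + (a + o + j)))  ≡⟨ cong f (shifted b a o j) ⟩
    f (b + (a + a) + (o + o) + (j + j))  ≡⟨ rec (j + j) (sample j<n) ⟩
    f (b + (a + a) + (j + j))            ≡⟨ cong f (unshifted b a j) ⟨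
    f (b + ((a + j) + (a + j)))          ≡⟨ f-digit (a + j) ⟩
    g (f (a + j))                        ∎)
    where
      open ≡-Reasoning
      shifted : ∀ b a o j → b + ((a + o + j) + (a + o + j)) ≡ b + (a + a) + (o + o) + (j + j)
      shifted = solve-∀
      unshifted : ∀ b a j → b + ((a + j) + (a + j)) ≡ b + (a + a) + (j + j)
      unshifted = solve-∀

m+m<1+n+n : ∀ {m n} → m < suc n → m + m < suc (n + n)
m+m<1+n+n (s≤s m≤n) = s≤s (+-mono-≤ m≤n m≤n)

thueMorse-pair : ∀ m → thueMorse (m + m) ≢ thueMorse (suc (m + m))
thueMorse-pair m e = not-¬ refl (trans (sym (thueMorse-even m)) (trans e (thueMorse-odd m)))

thueMorse-noThreeEqual : ∀ x → thueMorse x ≡ thueMorse (suc x) →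
                         thueMorse (suc x) ≡ thueMorse (suc (suc x)) → ⊥
thueMorse-noThreeEqual x e₁ e₂ with parity x
... | even a = thueMorse-pair a e₁
... | odd a  = thueMorse-pair (suc a) (reindex thueMorse 2+2a≡ (cong suc 2+2a≡) e₂)
  where
    2+2a≡ : suc (suc (a + a)) ≡ suc a + suc a
    2+2a≡ = cong suc (sym (+-suc a a))

thueMorse-oddShift : ∀ x y → thueMorse (x + x) ≡ thueMorse (suc (y + y)) →
                     thueMorse (suc (x + x)) ≡ thueMorse (suc (suc (y + y))) → thueMorse y ≡ thueMorse (suc y)
thueMorse-oddShift x y e₀ e₁ = begin
  thueMorse y                      ≡⟨ not-involutive (thueMorse y) ⟨
  not (not (thueMorse y))          ≡⟨ cong not (trans (sym e₀′) (thueMorse-even x)) ⟩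
  not (thueMorse x)                ≡⟨ trans (sym (thueMorse-odd x)) e₁ ⟩
  thueMorse (suc (suc (y + y)))    ≡⟨ cong thueMorse (cong suc (sym (+-suc y y))) ⟩
  thueMorse (suc y + suc y)        ≡⟨ thueMorse-even (suc y) ⟩
  thueMorse (suc y)                ∎
  where
    open ≡-Reasoning
    e₀′ : thueMorse (x + x) ≡ not (thueMorse y)
    e₀′ = trans e₀ (thueMorse-odd y)

thueMorse-oddShift-even : ∀ {a r} → Recurs thueMorse (a + a) (suc (r + r)) 2 →
                          thueMorse (a + r) ≡ thueMorse (suc (a + r))
thueMorse-oddShift-even {a} {r} rec = thueMorse-oddShift a (a + r)
  (sym (reindex thueMorse (position a r) refl (recurs-head thueMorse rec)))
  (sym (reindex thueMorse (cong suc (position a r)) refl (recurs-head thueMorse (recurs-suc thueMorse rec))))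
  where
    position : ∀ a r → a + a + suc (r + r) ≡ suc ((a + r) + (a + r))
    position = solve-∀

thueMorse-oddShift-odd : ∀ {a r} → Recurs thueMorse (suc (a + a)) (suc (r + r)) 2 →
                         thueMorse a ≡ thueMorse (suc a)
thueMorse-oddShift-odd {a} {r} rec = thueMorse-oddShift (suc (a + r)) a
  (reindex thueMorse (position a r) refl (recurs-head thueMorse rec))
  (reindex thueMorse (cong suc (position a r)) refl (recurs-head thueMorse (recurs-suc thueMorse rec)))
  where
    position : ∀ a r → suc (a + a) + suc (r + r) ≡ suc (a + r) + suc (a + r)
    position = solve-∀

thueMorse-overlapFree : ∀ {p} → Acc _<_ p → 1 ≤ p → ∀ i → ¬ Recurs thueMorse i p (suc p)
thueMorse-overlapFree {p} (acc rs) 1≤p i rec with parity p | parity i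
... | even zero    | _      = contradiction 1≤p λ ()
... | even (suc q) | even a = thueMorse-overlapFree (rs (m<m+n (suc q) z<s)) z<s a
  (recurs-halve (λ e → e) 0 thueMorse-even m+m<1+n+n rec)
... | even (suc q) | odd a  = thueMorse-overlapFree (rs (m<m+n (suc q) z<s)) z<s a
  (recurs-halve not-injective 1 thueMorse-odd m+m<1+n+n rec)
-- An odd period matches aligned pairs 2x, 2x+1 with misaligned ones, which yields three equal letters.
... | odd zero     | _      = thueMorse-noThreeEqual i
  (sym (reindex thueMorse (+-comm i 1) refl (recurs-head thueMorse rec)))
  (sym (reindex thueMorse (+-comm (suc i) 1) refl (recurs-head thueMorse (recurs-suc thueMorse rec))))
... | odd (suc r)  | even a = thueMorse-noThreeEqual (a + suc r)
  (thueMorse-oddShift-even {a} {suc r} (recurs-≤ thueMorse (s≤s (s≤s z≤n)) rec₄))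
  (thueMorse-oddShift-even {suc a} {suc r}
    (subst (λ x → Recurs thueMorse x p 2) (cong suc (sym (+-suc a a)))
      (recurs-suc thueMorse {suc (a + a)} (recurs-suc thueMorse {a + a} rec₄))))
  where
    rec₄ : Recurs thueMorse (a + a) p 4
    rec₄ = recurs-≤ thueMorse (s≤s (s≤s (s≤s (≤-trans (s≤s z≤n) (m≤n+m (suc r) r))))) rec
... | odd (suc r)  | odd a  = thueMorse-noThreeEqual a
  (thueMorse-oddShift-odd {a} {suc r} (recurs-≤ thueMorse (s≤s (s≤s z≤n)) rec₄))
  (thueMorse-oddShift-odd {suc a} {suc r}
    (subst (λ x → Recurs thueMorse x p 2) (cong (suc ∘ suc) (sym (+-suc a a)))
      (recurs-suc thueMorse {suc (suc (a + a))} (recurs-suc thueMorse {suc (a + a)} rec₄))))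
  where
    rec₄ : Recurs thueMorse (suc (a + a)) p 4
    rec₄ = recurs-≤ thueMorse (s≤s (s≤s (s≤s (≤-trans (s≤s z≤n) (m≤n+m (suc r) r))))) rec

-- A ternary word avoiding squares up to reversal

code : Bool → Bool → Fin 3
code false true  = Fin.zero
code true  false = Fin.suc Fin.zero
code false false = Fin.suc (Fin.suc Fin.zero)
code true  true  = Fin.suc (Fin.suc Fin.zero)

code-injectiveʳ : ∀ {a a′ b b′} → a ≡ a′ → code a b ≡ code a′ b′ → b ≡ b′
code-injectiveʳ {false} {b = false} {false} refl _ = refl
code-injectiveʳ {false} {b = true}  {true}  refl _ = refl
code-injectiveʳ {true}  {b = false} {false} refl _ = refl
code-injectiveʳ {true}  {b = true}  {true}  refl _ = refl

code-flip : ∀ {a a′ b b′ c} → a ≡ c → a′ ≡ not c → code a b ≡ code a′ b′ → b ≡ c × b′ ≡ not c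
code-flip {false} {b = false} {true}  refl refl _ = refl , refl
code-flip {true}  {b = true}  {false} refl refl _ = refl , refl
code-flip {false} {b = false} {false} refl refl ()
code-flip {false} {b = true}  {false} refl refl ()
code-flip {true}  {b = false} {true}  refl refl ()
code-flip {true}  {b = true}  {true}  refl refl ()

thueMorseSteps : InfWord 3
thueMorseSteps n = code (thueMorse n) (thueMorse (suc n))

≡-or-≡not : ∀ x y → x ≡ y ⊎ x ≡ not y
≡-or-≡not false false = inj₁ refl
≡-or-≡not true  true  = inj₁ refl
≡-or-≡not false true  = inj₂ refl
≡-or-≡not true  false = inj₂ refl

thueMorseSteps-squareFree : ∀ {i p} → 1 ≤ p → ¬ Recurs thueMorseSteps i p p
thueMorseSteps-squareFree {i} {p} 1≤p (recurs rec) with ≡-or-≡not (thueMorse (i + p)) (thueMorse i)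
... | inj₁ same = thueMorse-overlapFree (<-wellFounded p) 1≤p i (recurs λ j j≤p → agree j (≤-pred j≤p))
  where
    agree : ∀ j → j ≤ p → thueMorse (i + p + j) ≡ thueMorse (i + j)
    agree zero    _   = reindex thueMorse (sym (+-identityʳ (i + p))) (sym (+-identityʳ i)) same
    agree (suc j) j<p = reindex thueMorse (sym (+-suc (i + p) j)) (sym (+-suc i j))
      (code-injectiveʳ (agree j (<⇒≤ j<p)) (rec j j<p))
... | inj₂ flipped = not-¬ (proj₁ (constant p ≤-refl)) flipped
  where
    constant : ∀ j → j ≤ p → thueMorse (i + j) ≡ thueMorse i × thueMorse (i + p + j) ≡ not (thueMorse i)
    constant zero    _   =
      cong thueMorse (+-identityʳ i) , trans (cong thueMorse (+-identityʳ (i + p))) flipped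
    constant (suc j) j<p with constant j (<⇒≤ j<p)
    ... | c₁ , c₂ with code-flip c₁ c₂ (sym (rec j j<p))
    ...   | c₁′ , c₂′ =
      trans (cong thueMorse (+-suc i j)) c₁′ , trans (cong thueMorse (+-suc (i + p) j)) c₂′

thueMorseSteps-avoids : ∀ n → ¬ Encounters thueMorseSteps (unary (suc (suc n)))
thueMorseSteps-avoids n enc with encounters⇒power thueMorseSteps enc
... | i , p , 1≤p , power
  with subst (λ o → Recurs≃ thueMorseSteps i o p) (*-identityˡ p)
             (power⇒powerRecurs thueMorseSteps power (s≤s (s≤s z≤n)))
...   | inj₁ square = thueMorseSteps-squareFree 1≤p square
...   | inj₂ reversedSquare with p
...     | suc m = thueMorseSteps-squareFree (s≤s z≤n) (recursReversed⇒adjacent thueMorseSteps reversedSquare)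

-- A binary word avoiding fourth powers up to reversal

TrueOn : ℕ → ℕ → Set
TrueOn i n = ∀ j → j < n → periodDoubling (i + j) ≡ true

periodDoubling-falseIsolated : ∀ n → periodDoubling n ≡ false → periodDoubling (suc n) ≡ true
periodDoubling-falseIsolated n e with parity n
... | even m = contradiction (trans (sym (periodDoubling-even m)) e) λ ()
... | odd m  = subst (λ x → periodDoubling x ≡ true) (cong suc (+-suc m m)) (periodDoubling-even (suc m))

periodDoubling-oddPair : ∀ a → periodDoubling (suc (a + a)) ≡ true →
                         periodDoubling (suc (suc (suc (a + a)))) ≡ true → ⊥
periodDoubling-oddPair a e₁ e₃ =
  contradiction (trans (sym (periodDoubling-falseIsolated a pd[a]≡false)) pd[1+a]≡false) λ ()
  where
    pd[a]≡false : periodDoubling a ≡ false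
    pd[a]≡false = not-injective (trans (sym (periodDoubling-odd a)) e₁)
    pd[1+a]≡false : periodDoubling (suc a) ≡ false
    pd[1+a]≡false = not-injective (trans (sym (periodDoubling-odd (suc a)))
      (subst (λ x → periodDoubling x ≡ true) (cong (suc ∘ suc) (sym (+-suc a a))) e₃))

trueOn-at : ∀ {i n} → TrueOn i n → ∀ j → j < n → periodDoubling (j + i) ≡ true
trueOn-at {i} allTrue j j<n = subst (λ x → periodDoubling x ≡ true) (+-comm i j) (allTrue j j<n)

periodDoubling-noFourTrue : ∀ i → ¬ TrueOn i 4
periodDoubling-noFourTrue i allTrue with parity i
... | even a = periodDoubling-oddPair a (trueOn-at allTrue 1 (s≤s (s≤s z≤n)))
                                       (trueOn-at allTrue 3 ≤-refl)
... | odd a  = periodDoubling-oddPair a (trueOn-at allTrue 0 (s≤s z≤n))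
                                       (trueOn-at allTrue 2 (s≤s (s≤s (s≤s z≤n))))

periodDoubling-trueOrOdd : ∀ x → periodDoubling x ≡ true ⊎ ∃ λ m → x ≡ suc (m + m)
periodDoubling-trueOrOdd x with parity x
... | even m = inj₁ (periodDoubling-even m)
... | odd m  = inj₂ (m , refl)

trueOn-fromOdd : ∀ {i n} → (∀ j → j < n → ∀ m → i + j ≡ suc (m + m) → periodDoubling (i + j) ≡ true) →
                 TrueOn i n
trueOn-fromOdd {i} atOdd j j<n with periodDoubling-trueOrOdd (i + j)
... | inj₁ isTrue      = isTrue
... | inj₂ (m , oddPos) = atOdd j j<n m oddPos

+-swapʳ : ∀ i o j → i + o + j ≡ i + j + o
+-swapʳ = solve-∀

odd+odd : ∀ m x → suc (m + m) + suc (x + x) ≡ suc (m + x) + suc (m + x)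
odd+odd = solve-∀

-- In both lemmas below every matched pair of positions has odd sum; the even one of the two
-- carries a 1, hence so does the odd one.
recurs-oddOffset⇒trueOn : ∀ {i e n} → Recurs periodDoubling i (suc (e + e)) n → TrueOn i n
recurs-oddOffset⇒trueOn {i} {e} (recurs rec) = trueOn-fromOdd λ j j<n m oddPos →
  trans (sym (rec j j<n)) (trans (cong periodDoubling (position j m oddPos)) (periodDoubling-even (suc (m + e))))
  where
    position : ∀ j m → i + j ≡ suc (m + m) → i + suc (e + e) + j ≡ suc (m + e) + suc (m + e)
    position j m oddPos = trans (+-swapʳ i (suc (e + e)) j) (trans (cong (_+ suc (e + e)) oddPos) (odd+odd m e))

recursReversed-evenExcess⇒trueOn : ∀ {i e n} → RecursReversed periodDoubling i (n + (e + e)) n → TrueOn i n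
recursReversed-evenExcess⇒trueOn {i} {e} {n} (recursReversed rev) = trueOn-fromOdd λ k k<n m oddPos →
  let (j , k+j) = m≤n⇒∃[o]m+o≡n k<n
      j+k = trans (cong suc (+-comm j k)) k+j
  in trans (sym (rev j k j+k))
       (trans (cong periodDoubling (position j k m j+k oddPos)) (periodDoubling-even (suc (m + (j + e)))))
  where
    shift : ∀ i j k e → i + (suc (j + k) + (e + e)) + j ≡ i + k + suc ((j + e) + (j + e))
    shift = solve-∀
    position : ∀ j k m → suc (j + k) ≡ n → i + k ≡ suc (m + m) →
               i + (n + (e + e)) + j ≡ suc (m + (j + e)) + suc (m + (j + e))
    position j k m refl oddPos =
      trans (shift i j k e) (trans (cong (_+ suc ((j + e) + (j + e))) oddPos) (odd+odd m (j + e)))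

trueOn-recurs≃ : ∀ {i o n} → TrueOn i n → Recurs≃ periodDoubling i o n → TrueOn (i + o) n
trueOn-recurs≃ allTrue (inj₁ (recurs rec)) j j<n = trans (rec j j<n) (allTrue j j<n)
trueOn-recurs≃ allTrue (inj₂ (recursReversed rev)) j j<n =
  let (k , j+k) = m≤n⇒∃[o]m+o≡n j<n in
  trans (rev j k j+k) (allTrue k (subst (k <_) j+k (s≤s (m≤n+m k j))))

trueOn-++ : ∀ {i m n} → TrueOn i m → TrueOn (i + m) n → TrueOn i (m + n)
trueOn-++ {i} {m} {n} first second j j<m+n with j <? m
... | yes j<m = first j j<m
... | no  j≮m with m≤n⇒∃[o]m+o≡n (≮⇒≥ j≮m)
...   | r , refl = trans (cong periodDoubling (sym (+-assoc i m r))) (second r (+-cancelˡ-< m r n j<m+n))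

trueOn-blocks : ∀ {i p} b → (∀ {k} → k < b → TrueOn (i + k * p) p) → TrueOn i (b * p)
trueOn-blocks         zero    _      = λ j ()
trueOn-blocks {i} {p} (suc b) blocks = trueOn-++
  (subst (λ x → TrueOn x p) (+-identityʳ i) (blocks (s≤s z≤n)))
  (trueOn-blocks b λ k<b → subst (λ x → TrueOn x p) (sym (+-assoc i p _)) (blocks (s≤s k<b)))

trueOn⇒¬fourthPower : ∀ {i p} → 1 ≤ p → TrueOn i p → ¬ PowerRecurs periodDoubling 4 i p
trueOn⇒¬fourthPower {i} {p} 1≤p allTrue power = periodDoubling-noFourTrue i λ j j<4 →
  trueOn-blocks 4 (λ k<4 → trueOn-recurs≃ allTrue (power k<4)) j (<-≤-trans j<4 (*-monoʳ-≤ 4 1≤p))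

periodDoubling-halve : ∀ {i o q} → Recurs periodDoubling i (o + o) (q + q) →
                       Recurs periodDoubling ⌊ i /2⌋ o q
periodDoubling-halve {i} {o} {q} rec with parity i
... | even a = subst (λ x → Recurs periodDoubling x o q) (n≡⌊n+n/2⌋ a) (fromEven q rec)
  where
    fromEven : ∀ q → Recurs periodDoubling (a + a) (o + o) (q + q) → Recurs periodDoubling a o q
    fromEven zero     _   = recurs λ _ ()
    fromEven (suc q′) rec = recurs-halve not-injective 1 periodDoubling-odd
      (λ { (s≤s j≤q′) → ≤-<-trans (+-mono-≤ j≤q′ j≤q′) (+-monoʳ-< q′ (n<1+n q′)) })
      (recurs-suc periodDoubling rec)
... | odd a  = subst (λ x → Recurs periodDoubling x o q) (sym (⌊suc-double/2⌋ a))
  (recurs-halve not-injective 1 periodDoubling-odd (λ j<q → +-mono-< j<q j<q) rec)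

periodDoubling-fourthPowerFree : ∀ {p} → Acc _<_ p → 1 ≤ p → ∀ i → ¬ PowerRecurs periodDoubling 4 i p
periodDoubling-fourthPowerFree {p} (acc rs) 1≤p i power with power {1} (s≤s (s≤s z≤n)) | parity p
... | inj₂ reversed | _    = trueOn⇒¬fourthPower 1≤p (recursReversed-evenExcess⇒trueOn {e = 0} reversed) power
... | inj₁ copy     | odd e = trueOn⇒¬fourthPower 1≤p
  (recurs-oddOffset⇒trueOn {e = e} (subst (λ o → Recurs periodDoubling i o p) (*-identityˡ p) copy)) power
... | inj₁ _ | even zero = contradiction 1≤p λ ()
... | inj₁ copy₁ | even (suc q) with power {2} (s≤s (s≤s (s≤s z≤n))) | power {3} ≤-refl
...   | inj₂ reversed | _ = trueOn⇒¬fourthPower 1≤p (recursReversed-evenExcess⇒trueOn {e = suc q}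
  (subst (λ o → RecursReversed periodDoubling i o p) (cong (p +_) (+-identityʳ p)) reversed)) power
...   | inj₁ _ | inj₂ reversed = trueOn⇒¬fourthPower 1≤p (recursReversed-evenExcess⇒trueOn {e = p}
  (subst (λ o → RecursReversed periodDoubling i o p) (cong (λ x → p + (p + x)) (+-identityʳ p)) reversed)) power
...   | inj₁ copy₂ | inj₁ copy₃ =
  periodDoubling-fourthPowerFree (rs (m<m+n (suc q) z<s)) z<s ⌊ i /2⌋ λ {k} k<4 →
    inj₁ (periodDoubling-halve
      (subst (λ o → Recurs periodDoubling i o p) (*-distribˡ-+ k (suc q) (suc q)) (copy k<4)))
  where
    copy : ∀ {k} → k < 4 → Recurs periodDoubling i (k * p) p
    copy {0} _ = recurs-zero periodDoubling i p
    copy {1} _ = copy₁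
    copy {2} _ = copy₂
    copy {3} _ = copy₃
    copy {suc (suc (suc (suc _)))} (s≤s (s≤s (s≤s (s≤s ()))))

bit : Bool → Fin 2
bit false = Fin.zero
bit true  = Fin.suc Fin.zero

bit-injective : ∀ {x y} → bit x ≡ bit y → x ≡ y
bit-injective {false} {false} _ = refl
bit-injective {true}  {true}  _ = refl

periodDoublingWord : InfWord 2
periodDoublingWord = bit ∘ periodDoubling

periodDoublingWord-avoids : ∀ n → ¬ Encounters periodDoublingWord (unary (4 + n))
periodDoublingWord-avoids n enc with encounters⇒power periodDoublingWord enc
... | i , p , 1≤p , power = periodDoubling-fourthPowerFree (<-wellFounded p) 1≤p i λ k<4 →
  powerRecurs-injective bit-injective periodDoubling (power⇒powerRecurs periodDoublingWord power)
    (<-≤-trans k<4 (m≤m+n 4 n))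

-- Every binary word contains a cube up to reversal

_≃?_ : {A : Set} → DecidableEquality A → (u v : List A) → Dec (u ≃ v)
_≃?_ _≟_ u v = ≡-dec _≟_ v u ⊎-dec ≡-dec _≟_ v (reverse u)

padded : List (Fin 2) → InfWord 2
padded []      _       = Fin.zero
padded (a ∷ u) zero    = a
padded (a ∷ u) (suc x) = padded u x

factor-cong : ∀ {k} {v w : InfWord k} {N} → (∀ x → x < N → v x ≡ w x) →
              ∀ i m → i + m ≤ N → factor v i m ≡ factor w i m
factor-cong         agree i zero    _ = refl
factor-cong {N = N} agree i (suc m) i+m<N = cong₂ _∷_ (agree i (<-≤-trans (m<m+n i z<s) i+m<N))
  (factor-cong agree (suc i) m (subst (_≤ N) (+-suc i m) i+m<N))

prefix⇒padded : ∀ (w : InfWord 2) s u → factor w s (length u) ≡ u →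
                ∀ x → x < length u → w (s + x) ≡ padded u x
prefix⇒padded w s (a ∷ u) prefix zero    _         =
  trans (cong w (+-identityʳ s)) (proj₁ (∷-injective prefix))
prefix⇒padded w s (a ∷ u) prefix (suc x) (s≤s x<u) =
  trans (cong w (+-suc s x)) (prefix⇒padded w (suc s) u (proj₂ (∷-injective prefix)) x x<u)

power-prefix : ∀ (w : InfWord 2) u {n i p} → factor w 0 (length u) ≡ u → i + n * p ≤ length u →
               Power (padded u) n i p → Power w n i p
power-prefix w u {n} {i} {p} prefix bound power {j} j<n =
  subst₂ _≃_ (block i (<-≤-trans z<s j<n) (sym (+-identityʳ i))) (block (i + j * p) j<n refl) (power j<n)
  where
    agree : ∀ x → x < length u → padded u x ≡ w x
    agree x x<u = sym (prefix⇒padded w 0 u prefix x x<u)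
    blockEnd : ∀ {j} → j < n → i + j * p + p ≤ i + n * p
    blockEnd {j} j<n = ≤-trans (≤-reflexive (trans (+-assoc i (j * p) p) (cong (i +_) (+-comm (j * p) p))))
                               (+-monoʳ-≤ i (*-monoˡ-≤ p j<n))
    block : ∀ {j} x → j < n → x ≡ i + j * p → factor (padded u) x p ≡ factor w x p
    block x j<n refl = factor-cong agree x p (≤-trans (blockEnd j<n) bound)

CubeIn : List (Fin 2) → Set
CubeIn u = ∃ λ i → i < length u × ∃ λ p → p < length u ×
            (1 ≤ p × i + 3 * p ≤ length u × Power (padded u) 3 i p)

cubeIn? : ∀ u → Dec (CubeIn u)
cubeIn? u = anyUpTo? (λ i → anyUpTo? (λ p → (1 ≤? p) ×-dec ((i + 3 * p ≤? length u) ×-dec power? i p))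
                                     (length u))
                     (length u)
  where
    power? : ∀ i p → Dec (Power (padded u) 3 i p)
    power? i p = allUpTo? (λ j → _≃?_ _≟ᶠ_ (factor (padded u) i p) (factor (padded u) (i + j * p) p)) 3

data CubeForced : List (Fin 2) → Set where
  cube   : ∀ {u} → CubeIn u → CubeForced u
  branch : ∀ {u} → CubeForced (u ∷ʳ Fin.zero) → CubeForced (u ∷ʳ Fin.suc Fin.zero) → CubeForced u

cubeForced? : ℕ → ∀ u → Maybe (CubeForced u)
cubeForced? depth u with cubeIn? u | depth
... | yes c | _     = just (cube c)
... | no _  | zero  = nothing
... | no _  | suc d = zipWith branch (cubeForced? d (u ∷ʳ Fin.zero)) (cubeForced? d (u ∷ʳ Fin.suc Fin.zero))

cubeForced⇒power : ∀ {u} → CubeForced u → (w : InfWord 2) → factor w 0 (length u) ≡ u →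
                   ∃₂ λ i p → 1 ≤ p × Power w 3 i p
cubeForced⇒power {u} (cube (i , _ , p , _ , 1≤p , bound , power)) w prefix =
  i , p , 1≤p , power-prefix w u prefix bound power
cubeForced⇒power {u} (branch forced₀ forced₁) w prefix with w (length u) | extended
  where
    extended : factor w 0 (length (u ∷ʳ w (length u))) ≡ u ∷ʳ w (length u)
    extended = trans (cong (factor w 0) (length-++ u))
                     (trans (factor-+ w 0 (length u) 1) (cong (_++ [ w (length u) ]) prefix))
... | Fin.zero         | prefix′ = cubeForced⇒power forced₀ w prefix′
... | Fin.suc Fin.zero | prefix′ = cubeForced⇒power forced₁ w prefix′

binary-cube : (w : InfWord 2) → ∃₂ λ i p → 1 ≤ p × Power w 3 i p
binary-cube w = cubeForced⇒power (from-just (cubeForced? 10 [])) w refl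

binary-unavoidable : ∀ {n} → n ≤ 3 → (w : InfWord 2) → Encounters w (unary n)
binary-unavoidable n≤3 w with binary-cube w
... | i , p , 1≤p , power = power⇒encounters w 1≤p λ j<n → power (<-≤-trans j<n n≤3)

unary-unavoidable : ∀ n (w : InfWord 1) → Encounters w (unary n)
unary-unavoidable n w = power⇒encounters w {i = 0} {p = 1} (s≤s z≤n) λ _ → inj₁ (cong [_] (single _ _))
  where
    single : (x y : Fin 1) → x ≡ y
    single Fin.zero Fin.zero = refl

unavoidable : ∀ {j n} (x : Pattern n) → ((w : InfWord j) → Encounters w x) → ¬ Avoidable j x
unavoidable _ encounters (w , avoids) = avoids (encounters w)

theorem3 : (k : ℕ) → 2 ≤ k →
    ((k ≡ 2 ⊎ k ≡ 3) → AvoidabilityIndexIs (unary k) 3)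
    × (4 ≤ k → AvoidabilityIndexIs (unary k) 2)
theorem3 k (s≤s (s≤s {n = n} _)) = index3 , index2
  where
    k≤3 : (k ≡ 2 ⊎ k ≡ 3) → k ≤ 3
    k≤3 (inj₁ refl) = s≤s (s≤s z≤n)
    k≤3 (inj₂ refl) = ≤-refl
    index3 : (k ≡ 2 ⊎ k ≡ 3) → AvoidabilityIndexIs (unary k) 3
    index3 k≡2or3 = s≤s z≤n , (thueMorseSteps , thueMorseSteps-avoids n) , λ where
      1 _ _ → unavoidable (unary k) (unary-unavoidable k)
      2 _ _ → unavoidable (unary k) (binary-unavoidable (k≤3 k≡2or3))
      (suc (suc (suc _))) _ (s≤s (s≤s (s≤s ())))
    index2 : 4 ≤ k → AvoidabilityIndexIs (unary k) 2
    index2 (s≤s (s≤s (s≤s (s≤s {n = m} _)))) =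
      s≤s z≤n , (periodDoublingWord , periodDoublingWord-avoids m) , λ where
      1 _ _ → unavoidable (unary k) (unary-unavoidable k)
      (suc (suc _)) _ (s≤s (s≤s ()))
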